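{- Let $(\mathcal{P};\Phi)$ be an extended simple process such that $(\mathcal{P};\Phi;\varnothing)\xRightarrow{\mathsf{tr}}_c(\mathcal{P}';\Phi';\mathcal{S}')$ in the compressed symbolic semantics, and let $\theta\in\mathsf{Sol}(\Phi';\mathcal{S}')$. Then $(\mathcal{P};\Phi)\xRightarrow{\mathsf{tr}\theta}_c(\mathcal{P}'\lambda;\Phi'\lambda)$ in the compressed concrete semantics, where $\lambda$ is the first-order substitution associated to $\theta$.
   Context: Terms: signature $\Sigma$, names, first-order variables $\mathcal{X}$, handles $\mathcal{W}$, equational theory $\mathsf{E}$; recipes are terms over handles. A fixed set $\mathcal{M}$ of ground terms (containing a public constant) defines validity: a ground term is valid if each of its subterms is $\mathsf{E}$-equal to an element of $\mathcal{M}$. Basic processes on channel $c$: $0$, $\mathtt{if}\ u=v\ \mathtt{then}\ P\ \mathtt{else}\ Q$, $\mathtt{in}(c,x).P$, $\mathtt{out}(c,u).P$; simple processes are multisets of basic processes on pairwise distinct channels; frames are finite maps $\{w\triangleright u\}$ from handles to terms; extended simple processes are $(\mathcal{P};\Phi)$ with ground valid frame. Concrete steps: $\mathtt{in}(c,x).Q\xrightarrow{\mathtt{in}(c,M)}Q\{x\mapsto u\}$ if $M$ is a recipe over $\mathrm{dom}\Phi$, $M\Phi=_\mathsf{E}u$, $M\Phi$ and $u$ valid; $\mathtt{out}(c,u).Q\xrightarrow{\mathtt{out}(c,w)}Q$ extending the frame with $w\triangleright u$ ($w$ fresh, $u$ valid); conditionals $\tau$-reduce to the then-branch iff $u=_\mathsf{E}v$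 and both valid, otherwise to the else-branch. Compressed semantics: on a basic process with frame, least relations $\xrightarrow{\mathsf{tr}}_\ell$ ($\ell\in\{i^*,i^+,o^*\}$) with: input step then $\xrightarrow{\mathsf{tr}}_{i^*}$ gives $\xrightarrow{\mathtt{in}(c,M)\cdot\mathsf{tr}}_\ell$ for $\ell\in\{i^*,i^+\}$; output step then $\xrightarrow{\mathsf{tr}}_{o^*}$ gives $\xrightarrow{\mathtt{out}(c,w)\cdot\mathsf{tr}}_\ell$ for $\ell\in\{i^*,o^*\}$; a $\tau$ step then $\xrightarrow{\mathsf{tr}}_\ell$ gives $\xrightarrow{\mathsf{tr}}_\ell$; $0$, $\mathtt{in}(c,x).Q$ and $\mathtt{out}(c,u).Q$ with $u$ not valid do $\xrightarrow{\epsilon}_{o^*}$ to themselves; $0$ and $\mathtt{out}(c,u).Q$ with $u$ not valid do $\xrightarrow{\epsilon}_{i^*}$ to $\bot$. On simple processes, a $\xrightarrow{\mathsf{tr}}_{i^+}$ step of one basic process $Q$ to $Q'$ gives $(\{Q\}\uplus\mathcal{P};\Phi)\xRightarrow{\mathsf{tr}}_c(\{Q'\}\uplus\mathcal{P};\Phi')$ if $Q'\neq\bot$ and $\xRightarrow{\mathsf{tr}}_c(\varnothing;\Phi')$ if $Q'=\bot$; steps compose by concatenating labels. Symbolic setting: second-order variables; constraint systems $(\Phi;\mathcal{S})$ with constraints $D\vdash^?X:x$, $u=^?v$, $u\neq^?v$, well-formed (unique deduction constraint per variable, acyclic dependency). A solution $\theta$ assigns to each second-order $X$ a recipe over $D$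 such that a ground $\lambda$ exists with $(X\theta)(\Phi\lambda)=_\mathsf{E}x\lambda$ (both valid) for each $D\vdash^?X:x$, $u\lambda=_\mathsf{E}v\lambda$ (both valid) for each $u=^?v$, $u\lambda\neq_\mathsf{E}v\lambda$ or one invalid for each $u\neq^?v$, and $\Phi\lambda$ valid; this $\lambda$ is the associated first-order substitution. Symbolic steps: $\mathtt{in}(c,y).P\xrightarrow{\mathtt{in}(c,X)}P\{y\mapsto x\}$ adding $\mathrm{dom}(\Phi)\vdash^?X:x$ with $X,x$ fresh; $\mathtt{out}(c,u).P\xrightarrow{\mathtt{out}(c,w)}P$ adding $w\triangleright u$; conditionals $\tau$-reduce to then-branch adding $u=^?v$ or else-branch adding $u\neq^?v$. The compressed symbolic semantics uses the same rules as the compressed concrete semantics except that the conditions "$u$ not valid" are replaced by adding $u\neq^?u$ to the constraints. $\mathsf{tr}\theta$ denotes the trace obtained by replacing each second-order variable by its image under $\theta$. -}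

module Defs where

open import Data.Nat using (ℕ; zero; suc; _≟_)
open import Data.Fin using (Fin)
open import Data.Vec using (Vec; []; _∷_; lookup)
open import Data.List using (List; []; _∷_; _++_; _∷ʳ_; map)
open import Data.List.Membership.Propositional using (_∈_; _∉_)
open import Data.List.Relation.Unary.All using (All)
open import Data.List.Relation.Unary.Unique.Propositional using (Unique)
open import Data.List.Relation.Binary.Pointwise using (Pointwise)
open import Data.Maybe using (Maybe; just; nothing)
open import Data.Product using (Σ; ∃; _×_; _,_; proj₁; proj₂)
open import Data.Sum using (_⊎_)
open import Data.Empty using (⊥)
open import Relation.Nullary using (¬_; yes; no)
open import Relation.Binary.PropositionalEquality using (_≡_; _≢_; sym; subst)

-- First-order variables, second-order variables, handles and channels
-- are all represented by natural numbers (four disjoint sorts).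

record Signature : Set₁ where
  field
    Fun  : Set
    ar   : Fun → ℕ
    Name : Set

module Terms (Sg : Signature) where
  open Signature Sg

  data Tm (A : Set) : Set where
    at : A → Tm A
    fn : (f : Fun) → Vec (Tm A) (ar f) → Tm A

  mutual
    bind : {A B : Set} → (A → Tm B) → Tm A → Tm B
    bind σ (at a)    = σ a
    bind σ (fn f ts) = fn f (bindV σ ts)

    bindV : {A B : Set} {n : ℕ} → (A → Tm B) → Vec (Tm A) n → Vec (Tm B) n
    bindV σ []       = []
    bindV σ (t ∷ ts) = bind σ t ∷ bindV σ ts

  data _⊑_ {A : Set} : Tm A → Tm A → Set where
    here  : ∀ {t} → t ⊑ t
    there : ∀ {s f ts} (i : Fin (ar f)) → s ⊑ lookup ts i → s ⊑ fn f ts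

  data Atom : Set where
    nm : Name → Atom
    vr : ℕ → Atom

  Term : Set
  Term = Tm Atom

  -- recipes: terms over handles (no names, no variables)
  Recipe : Set
  Recipe = Tm ℕ

  -- first-order substitutions (identity = at ∘ vr outside the intended domain)
  Subst : Set
  Subst = ℕ → Term

  substT : Subst → Term → Term
  substT σ = bind act
    where
      act : Atom → Term
      act (nm n) = at (nm n)
      act (vr x) = σ x

  _∈V_ : ℕ → Term → Set
  x ∈V t = at (vr x) ⊑ t

  Ground : Term → Set
  Ground t = ∀ x → ¬ (x ∈V t)

record Theory (Sg : Signature) : Set₁ where
  open Signature Sg
  open Terms Sg
  field
    Ax       : Term → Term → Set
    𝓜        : Term → Set
    𝓜-ground : ∀ t → 𝓜 t → Ground t
    pub      : Fun
    pub-ar   : ar pub ≡ 0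
    pub-𝓜    : 𝓜 (fn pub (subst (Vec Term) (sym pub-ar) []))

module Model (Sg : Signature) (Th : Theory Sg) where
  open Signature Sg
  open Terms Sg public
  open Theory Th

  pubT : Term
  pubT = fn pub (subst (Vec Term) (sym pub-ar) [])

  data _≈E_ : Term → Term → Set where
    E-ax    : ∀ {l r} → Ax l r → (σ : Subst) → substT σ l ≈E substT σ r
    E-refl  : ∀ {t} → t ≈E t
    E-sym   : ∀ {t u} → t ≈E u → u ≈E t
    E-trans : ∀ {t u v} → t ≈E u → u ≈E v → t ≈E v
    E-cong  : ∀ f {us vs : Vec Term (ar f)} →
            (∀ i → lookup us i ≈E lookup vs i) → fn f us ≈E fn f vs

  Valid : Term → Set
  Valid t = Ground t × (∀ s → s ⊑ t → Σ Term λ m → 𝓜 m × (s ≈E m))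

  Frame : Set
  Frame = List (ℕ × Term)

  dom : Frame → List ℕ
  dom = map proj₁

  look : Frame → ℕ → Term
  look [] w = pubT          -- never used for recipes over dom Φ
  look ((w' , t) ∷ Φ) w with w ≟ w'
  ... | yes _ = t
  ... | no  _ = look Φ w

  _·_ : Recipe → Frame → Term
  M · Φ = bind (look Φ) M

  RecipeOver : List ℕ → Recipe → Set
  RecipeOver D M = ∀ w → at w ⊑ M → w ∈ D

  substF : Subst → Frame → Frame
  substF σ = map (λ p → proj₁ p , substT σ (proj₂ p))

  ValidFrame : Frame → Set
  ValidFrame Φ = All (λ p → Valid (proj₂ p)) Φ

  data Proc : Set where
    nil : Proc
    ite : Term → Term → Proc → Proc → Proc
    inp : ℕ → ℕ → Proc → Proc
    out : ℕ → Term → Proc → Proc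

  data OnCh (c : ℕ) : Proc → Set where
    nil : OnCh c nil
    ite : ∀ {u v P Q} → OnCh c P → OnCh c Q → OnCh c (ite u v P Q)
    inp : ∀ {x P} → OnCh c P → OnCh c (inp c x P)
    out : ∀ {u P} → OnCh c P → OnCh c (out c u P)

  SimpleProc : List Proc → Set
  SimpleProc Ps = Σ (List ℕ) λ cs → Pointwise OnCh cs Ps × Unique cs

  data FV (x : ℕ) : Proc → Set where
    ite-u : ∀ {u v P Q} → x ∈V u → FV x (ite u v P Q)
    ite-v : ∀ {u v P Q} → x ∈V v → FV x (ite u v P Q)
    ite-P : ∀ {u v P Q} → FV x P → FV x (ite u v P Q)
    ite-Q : ∀ {u v P Q} → FV x Q → FV x (ite u v P Q)
    inp-P : ∀ {c y P} → x ≢ y → FV x P → FV x (inp c y P)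
    out-u : ∀ {c u P} → x ∈V u → FV x (out c u P)
    out-P : ∀ {c u P} → FV x P → FV x (out c u P)

  Closed : Proc → Set
  Closed P = ∀ x → ¬ FV x P

  data Occ (x : ℕ) : Proc → Set where
    ite-u : ∀ {u v P Q} → x ∈V u → Occ x (ite u v P Q)
    ite-v : ∀ {u v P Q} → x ∈V v → Occ x (ite u v P Q)
    ite-P : ∀ {u v P Q} → Occ x P → Occ x (ite u v P Q)
    ite-Q : ∀ {u v P Q} → Occ x Q → Occ x (ite u v P Q)
    inp-b : ∀ {c P} → Occ x (inp c x P)
    inp-P : ∀ {c y P} → Occ x P → Occ x (inp c y P)
    out-u : ∀ {c u P} → x ∈V u → Occ x (out c u P)
    out-P : ∀ {c u P} → Occ x P → Occ x (out c u P)

  ExtSimple : List Proc → Frame → Set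
  ExtSimple Ps Φ = SimpleProc Ps × All Closed Ps × ValidFrame Φ × Unique (dom Φ)

  unbind : Subst → ℕ → Subst
  unbind σ y z with z ≟ y
  ... | yes _ = at (vr y)
  ... | no  _ = σ z

  substP : Subst → Proc → Proc
  substP σ nil           = nil
  substP σ (ite u v P Q) = ite (substT σ u) (substT σ v) (substP σ P) (substP σ Q)
  substP σ (inp c y P)   = inp c y (substP (unbind σ y) P)
  substP σ (out c u P)   = out c (substT σ u) (substP σ P)

  single : ℕ → Term → Subst
  single x u z with z ≟ x
  ... | yes _ = u
  ... | no  _ = at (vr z)

  data Act (R : Set) : Set where
    inA  : ℕ → R → Act R
    outA : ℕ → ℕ → Act R

  mapAct : {A B : Set} → (A → B) → Act A → Act B
  mapAct f (inA c M)  = inA c (f M)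
  mapAct f (outA c w) = outA c w

  CTrace : Set
  CTrace = List (Act Recipe)

  STrace : Set
  STrace = List (Act ℕ)      -- second-order variables are naturals

  -- compressed labels i*, i+, o*
  data Lbl : Set where
    iS iP oS : Lbl

  data InL : Lbl → Set where
    iS : InL iS
    iP : InL iP

  data OutL : Lbl → Set where
    iS : OutL iS
    oS : OutL oS

  -- Compressed concrete semantics on a basic process with frame;
  -- result nothing = ⊥.

  data CStep : Lbl → Proc → Frame → CTrace → Maybe Proc → Frame → Set where
    c-in   : ∀ {ℓ c x Q Φ M u tr R Φ'} → InL ℓ →
             RecipeOver (dom Φ) M → (M · Φ) ≈E u → Valid (M · Φ) → Valid u →
             CStep iS (substP (single x u) Q) Φ tr R Φ' →
             CStep ℓ (inp c x Q) Φ (inA c M ∷ tr) R Φ'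
    c-out  : ∀ {ℓ c u Q Φ w tr R Φ'} → OutL ℓ →
             w ∉ dom Φ → Valid u →
             CStep oS Q (Φ ∷ʳ (w , u)) tr R Φ' →
             CStep ℓ (out c u Q) Φ (outA c w ∷ tr) R Φ'
    c-then : ∀ {ℓ u v P Q Φ tr R Φ'} →
             u ≈E v → Valid u → Valid v →
             CStep ℓ P Φ tr R Φ' → CStep ℓ (ite u v P Q) Φ tr R Φ'
    c-else : ∀ {ℓ u v P Q Φ tr R Φ'} →
             ¬ (u ≈E v × Valid u × Valid v) →
             CStep ℓ Q Φ tr R Φ' → CStep ℓ (ite u v P Q) Φ tr R Φ'
    c-nil-o : ∀ {Φ} → CStep oS nil Φ [] (just nil) Φ
    c-inp-o : ∀ {c x Q Φ} → CStep oS (inp c x Q) Φ [] (just (inp c x Q)) Φ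
    c-bad-o : ∀ {c u Q Φ} → ¬ Valid u →
              CStep oS (out c u Q) Φ [] (just (out c u Q)) Φ
    c-nil-i : ∀ {Φ} → CStep iS nil Φ [] nothing Φ
    c-bad-i : ∀ {c u Q Φ} → ¬ Valid u → CStep iS (out c u Q) Φ [] nothing Φ

  data CSimple : List Proc → Frame → CTrace → List Proc → Frame → Set where
    done : ∀ {Ps Φ} → CSimple Ps Φ [] Ps Φ
    keep : ∀ {Ps₁ Ps₂ Q Q' Φ Φ' tr tr' Pf Φf} →
           CStep iP Q Φ tr (just Q') Φ' →
           CSimple (Ps₁ ++ Q' ∷ Ps₂) Φ' tr' Pf Φf →
           CSimple (Ps₁ ++ Q ∷ Ps₂) Φ (tr ++ tr') Pf Φf
    kill : ∀ {Ps₁ Ps₂ Q Φ Φ' tr tr' Pf Φf} →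
           CStep iP Q Φ tr nothing Φ' →
           CSimple [] Φ' tr' Pf Φf →
           CSimple (Ps₁ ++ Q ∷ Ps₂) Φ (tr ++ tr') Pf Φf

  data Constr : Set where
    ded  : List ℕ → ℕ → ℕ → Constr
    eqc  : Term → Term → Constr
    neqc : Term → Term → Constr

  OccC : ℕ → Constr → Set
  OccC x (ded D X y) = x ≡ y
  OccC x (eqc u v)   = x ∈V u ⊎ x ∈V v
  OccC x (neqc u v)  = x ∈V u ⊎ x ∈V v

  OccSV : ℕ → Constr → Set
  OccSV X (ded D Y y) = X ≡ Y
  OccSV X (eqc u v)   = ⊥
  OccSV X (neqc u v)  = ⊥

  FreshSV : List Constr → ℕ → Set
  FreshSV S X = All (λ c → ¬ OccSV X c) S

  FreshV : List Proc → Proc → Frame → List Constr → ℕ → Set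
  FreshV ctx P Φ S x =
    All (λ Q → ¬ Occ x Q) ctx × ¬ Occ x P ×
    All (λ p → ¬ (x ∈V proj₂ p)) Φ × All (λ c → ¬ OccC x c) S

  -- Compressed symbolic semantics on a basic process (ctx = the other
  -- processes of the simple process, used for freshness)

  data SStep (ctx : List Proc) : Lbl → Proc → Frame → List Constr → STrace →
                                 Maybe Proc → Frame → List Constr → Set where
    s-in   : ∀ {ℓ c y Q Φ S X x tr R Φ' S'} → InL ℓ →
             FreshSV S X → FreshV ctx (inp c y Q) Φ S x →
             SStep ctx iS (substP (single y (at (vr x))) Q) Φ
                   (S ∷ʳ ded (dom Φ) X x) tr R Φ' S' →
             SStep ctx ℓ (inp c y Q) Φ S (inA c X ∷ tr) R Φ' S'
    s-out  : ∀ {ℓ c u Q Φ S w tr R Φ' S'} → OutL ℓ →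
             w ∉ dom Φ →
             SStep ctx oS Q (Φ ∷ʳ (w , u)) S tr R Φ' S' →
             SStep ctx ℓ (out c u Q) Φ S (outA c w ∷ tr) R Φ' S'
    s-then : ∀ {ℓ u v P Q Φ S tr R Φ' S'} →
             SStep ctx ℓ P Φ (S ∷ʳ eqc u v) tr R Φ' S' →
             SStep ctx ℓ (ite u v P Q) Φ S tr R Φ' S'
    s-else : ∀ {ℓ u v P Q Φ S tr R Φ' S'} →
             SStep ctx ℓ Q Φ (S ∷ʳ neqc u v) tr R Φ' S' →
             SStep ctx ℓ (ite u v P Q) Φ S tr R Φ' S'
    s-nil-o : ∀ {Φ S} → SStep ctx oS nil Φ S [] (just nil) Φ S
    s-inp-o : ∀ {c x Q Φ S} →
              SStep ctx oS (inp c x Q) Φ S [] (just (inp c x Q)) Φ S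
    s-bad-o : ∀ {c u Q Φ S} →
              SStep ctx oS (out c u Q) Φ S [] (just (out c u Q)) Φ (S ∷ʳ neqc u u)
    s-nil-i : ∀ {Φ S} → SStep ctx iS nil Φ S [] nothing Φ S
    s-bad-i : ∀ {c u Q Φ S} →
              SStep ctx iS (out c u Q) Φ S [] nothing Φ (S ∷ʳ neqc u u)

  data SSimple : List Proc → Frame → List Constr → STrace →
                 List Proc → Frame → List Constr → Set where
    done : ∀ {Ps Φ S} → SSimple Ps Φ S [] Ps Φ S
    keep : ∀ {Ps₁ Ps₂ Q Q' Φ Φ' S S' tr tr' Pf Φf Sf} →
           SStep (Ps₁ ++ Ps₂) iP Q Φ S tr (just Q') Φ' S' →
           SSimple (Ps₁ ++ Q' ∷ Ps₂) Φ' S' tr' Pf Φf Sf →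
           SSimple (Ps₁ ++ Q ∷ Ps₂) Φ S (tr ++ tr') Pf Φf Sf
    kill : ∀ {Ps₁ Ps₂ Q Φ Φ' S S' tr tr' Pf Φf Sf} →
           SStep (Ps₁ ++ Ps₂) iP Q Φ S tr nothing Φ' S' →
           SSimple [] Φ' S' tr' Pf Φf Sf →
           SSimple (Ps₁ ++ Q ∷ Ps₂) Φ S (tr ++ tr') Pf Φf Sf

  SatC : Frame → (ℕ → Recipe) → Subst → Constr → Set
  SatC Φ θ lam (ded D X x) =
    RecipeOver D (θ X) × Valid (θ X · substF lam Φ) × Valid (lam x) ×
    (θ X · substF lam Φ) ≈E lam x
  SatC Φ θ lam (eqc u v) =
    (substT lam u ≈E substT lam v) × Valid (substT lam u) × Valid (substT lam v)
  SatC Φ θ lam (neqc u v) =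
    ¬ (substT lam u ≈E substT lam v) ⊎ ¬ Valid (substT lam u) ⊎ ¬ Valid (substT lam v)

  record IsSolWith (Φ : Frame) (S : List Constr) (θ : ℕ → Recipe) (lam : Subst) : Set where
    field
      lam-ground  : ∀ x → Ground (lam x)
      frame-valid : ValidFrame (substF lam Φ)
      sat         : All (SatC Φ θ lam) S

module Submission where

open import Defs
open import Data.List using (List; []; map)
open import Data.Nat using (ℕ)

open import Data.Nat using (_≟_)
open import Data.Fin using (zero; suc)
open import Data.Vec using (Vec; []; _∷_; lookup)
open import Data.List using (_∷_; _++_; _∷ʳ_)
open import Data.List.Properties using (map-++; ++-assoc; ++-identityʳ)
open import Data.List.Membership.Propositional using (_∈_; _∉_)
open import Data.List.Relation.Unary.Any using (here; there)
open import Data.List.Relation.Unary.All using (All; []; _∷_)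
open import Data.List.Relation.Unary.All.Properties using (++⁻ˡ; ∷ʳ⁻)
open import Data.Maybe using (Maybe)
import Data.Maybe as Maybe
open import Data.Product using (∃; _×_; _,_; proj₁; proj₂; map₁; map₂′; zip′)
open import Data.Sum using (_⊎_; inj₁; inj₂)
open import Data.Empty using (⊥-elim)
open import Relation.Nullary using (¬_; yes; no)
open import Relation.Binary.PropositionalEquality

-- Proof idea: induction on the symbolic derivation, replaying each symbolic
-- step concretely on its λ-instance. Constraints and frame only grow, so every
-- constraint met along the way belongs to 𝒮' and is satisfied by (θ, λ), and
-- a recipe over an earlier frame evaluates the same in the final frame Φ'λ.
-- For an input, the fresh variable x receives λ x; since λ is ground and x
-- does not occur in the continuation, instantiating the bound variable by x
-- and then applying λ is the same as applying λ under the binder and then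
-- instantiating the bound variable by λ x.

_≼_ : {A : Set} → List A → List A → Set
xs ≼ ys = ∃ λ zs → ys ≡ xs ++ zs

≼-refl : {A : Set} (xs : List A) → xs ≼ xs
≼-refl xs = [] , sym (++-identityʳ xs)

≼-∷ʳ : {A : Set} (xs : List A) (x : A) → xs ≼ (xs ∷ʳ x)
≼-∷ʳ xs x = x ∷ [] , refl

≼-trans : {A : Set} {xs ys zs : List A} → xs ≼ ys → ys ≼ zs → xs ≼ zs
≼-trans {xs = xs} (as , refl) (bs , refl) = as ++ bs , ++-assoc xs as bs

≼-map : {A B : Set} (f : A → B) {xs ys : List A} → xs ≼ ys → map f xs ≼ map f ys
≼-map f {xs} (zs , refl) = map f zs , map-++ f xs zs

∷ʳ-≼ : {A : Set} {xs ys : List A} {x : A} → (xs ∷ʳ x) ≼ ys → xs ≼ ys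
∷ʳ-≼ {xs = xs} {x = x} = ≼-trans (≼-∷ʳ xs x)

All-≼ : {A : Set} {P : A → Set} {xs ys : List A} → All P ys → xs ≼ ys → All P xs
All-≼ {xs = xs} pys (zs , refl) = ++⁻ˡ xs pys

All-last : {A : Set} {P : A → Set} {xs ys : List A} (x : A) →
           All P ys → (xs ∷ʳ x) ≼ ys → P x
All-last x pys xs∷ʳx≼ys = proj₂ (∷ʳ⁻ (All-≼ pys xs∷ʳx≼ys))

module TermLaws (Sg : Signature) where
  open Terms Sg

  mutual
    bind-cong : {A B : Set} (σ σ' : A → Tm B) (t : Tm A) →
                (∀ a → at a ⊑ t → σ a ≡ σ' a) → bind σ t ≡ bind σ' t
    bind-cong σ σ' (at a)    eq = eq a here
    bind-cong σ σ' (fn f ts) eq =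
      cong (fn f) (bindV-cong σ σ' ts (λ i a a⊑tᵢ → eq a (there i a⊑tᵢ)))

    bindV-cong : {A B : Set} {n : ℕ} (σ σ' : A → Tm B) (ts : Vec (Tm A) n) →
                 (∀ i a → at a ⊑ lookup ts i → σ a ≡ σ' a) → bindV σ ts ≡ bindV σ' ts
    bindV-cong σ σ' []       eq = refl
    bindV-cong σ σ' (t ∷ ts) eq =
      cong₂ _∷_ (bind-cong σ σ' t (eq zero)) (bindV-cong σ σ' ts (λ i → eq (suc i)))

  mutual
    bind-assoc : {A B C : Set} (σ : B → Tm C) (τ : A → Tm B) (t : Tm A) →
                 bind σ (bind τ t) ≡ bind (λ a → bind σ (τ a)) t
    bind-assoc σ τ (at a)    = refl
    bind-assoc σ τ (fn f ts) = cong (fn f) (bindV-assoc σ τ ts)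

    bindV-assoc : {A B C : Set} {n : ℕ} (σ : B → Tm C) (τ : A → Tm B) (ts : Vec (Tm A) n) →
                  bindV σ (bindV τ ts) ≡ bindV (λ a → bind σ (τ a)) ts
    bindV-assoc σ τ []       = refl
    bindV-assoc σ τ (t ∷ ts) = cong₂ _∷_ (bind-assoc σ τ t) (bindV-assoc σ τ ts)

  mutual
    bind-identity : {A : Set} (t : Tm A) → bind at t ≡ t
    bind-identity (at a)    = refl
    bind-identity (fn f ts) = cong (fn f) (bindV-identity ts)

    bindV-identity : {A : Set} {n : ℕ} (ts : Vec (Tm A) n) → bindV at ts ≡ ts
    bindV-identity []       = refl
    bindV-identity (t ∷ ts) = cong₂ _∷_ (bind-identity t) (bindV-identity ts)

module Substitution (Sg : Signature) (Th : Theory Sg) where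
  open Model Sg Th
  open TermLaws Sg

  atomSubst : Subst → Atom → Term
  atomSubst σ (nm n) = at (nm n)
  atomSubst σ (vr x) = σ x

  substT≡bind : ∀ σ t → substT σ t ≡ bind (atomSubst σ) t
  substT≡bind σ t = bind-cong _ _ t λ { (nm n) _ → refl ; (vr x) _ → refl }

  substT-cong : ∀ σ σ' t → (∀ z → z ∈V t → σ z ≡ σ' z) → substT σ t ≡ substT σ' t
  substT-cong σ σ' t eq = begin
    substT σ t                ≡⟨ substT≡bind σ t ⟩
    bind (atomSubst σ) t      ≡⟨ bind-cong _ _ t (λ { (nm n) _ → refl ; (vr x) x∈t → eq x x∈t }) ⟩
    bind (atomSubst σ') t     ≡⟨ substT≡bind σ' t ⟨
    substT σ' t               ∎
    where open ≡-Reasoning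

  substT-id : ∀ σ t → (∀ z → z ∈V t → σ z ≡ at (vr z)) → substT σ t ≡ t
  substT-id σ t eq = begin
    substT σ t                ≡⟨ substT≡bind σ t ⟩
    bind (atomSubst σ) t      ≡⟨ bind-cong _ at t (λ { (nm n) _ → refl ; (vr x) x∈t → eq x x∈t }) ⟩
    bind at t                 ≡⟨ bind-identity t ⟩
    t                         ∎
    where open ≡-Reasoning

  substT-ground : ∀ σ t → Ground t → substT σ t ≡ t
  substT-ground σ t ground = substT-id σ t (λ z z∈t → ⊥-elim (ground z z∈t))

  substT-∘ : ∀ σ τ ρ t → (∀ z → substT σ (τ z) ≡ ρ z) → substT σ (substT τ t) ≡ substT ρ t
  substT-∘ σ τ ρ t eq = begin
    substT σ (substT τ t)                          ≡⟨ cong (substT σ) (substT≡bind τ t) ⟩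
    substT σ (bind (atomSubst τ) t)                ≡⟨ substT≡bind σ (bind (atomSubst τ) t) ⟩
    bind (atomSubst σ) (bind (atomSubst τ) t)      ≡⟨ bind-assoc _ _ t ⟩
    bind (λ a → bind (atomSubst σ) (atomSubst τ a)) t
      ≡⟨ bind-cong _ _ t (λ { (nm n) _ → refl
                            ; (vr x) _ → trans (sym (substT≡bind σ (τ x))) (eq x) }) ⟩
    bind (atomSubst ρ) t                           ≡⟨ substT≡bind ρ t ⟨
    substT ρ t                                     ∎
    where open ≡-Reasoning

  -- Splitting on z ≟ y directly would also abstract the test inside unbind and single.
  ≡-or-≢ : (a b : ℕ) → a ≡ b ⊎ a ≢ b
  ≡-or-≢ a b with a ≟ b
  ... | yes a≡b = inj₁ a≡b
  ... | no a≢b  = inj₂ a≢b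

  ∈V-var⁻ : ∀ {x z} → x ∈V at (vr z) → x ≡ z
  ∈V-var⁻ here = refl

  unbind-≡ : ∀ σ y → unbind σ y y ≡ at (vr y)
  unbind-≡ σ y with y ≟ y
  ... | yes _  = refl
  ... | no y≢y = ⊥-elim (y≢y refl)

  unbind-≢ : ∀ σ y z → z ≢ y → unbind σ y z ≡ σ z
  unbind-≢ σ y z z≢y with z ≟ y
  ... | yes z≡y = ⊥-elim (z≢y z≡y)
  ... | no _    = refl

  single-≡ : ∀ y u → single y u y ≡ u
  single-≡ y u with y ≟ y
  ... | yes _  = refl
  ... | no y≢y = ⊥-elim (y≢y refl)

  single-≢ : ∀ y u z → z ≢ y → single y u z ≡ at (vr z)
  single-≢ y u z z≢y with z ≟ y
  ... | yes z≡y = ⊥-elim (z≢y z≡y)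
  ... | no _    = refl

  substP-cong : ∀ P σ σ' → (∀ z → FV z P → σ z ≡ σ' z) → substP σ P ≡ substP σ' P
  substP-cong nil           σ σ' eq = refl
  substP-cong (ite u v P Q) σ σ' eq =
    cong₂ (λ (u' , v') (P' , Q') → ite u' v' P' Q')
      (cong₂ _,_ (substT-cong σ σ' u (λ z z∈u → eq z (ite-u z∈u)))
                 (substT-cong σ σ' v (λ z z∈v → eq z (ite-v z∈v))))
      (cong₂ _,_ (substP-cong P σ σ' (λ z z∈P → eq z (ite-P z∈P)))
                 (substP-cong Q σ σ' (λ z z∈Q → eq z (ite-Q z∈Q))))
  substP-cong (inp c y P)   σ σ' eq = cong (inp c y) (substP-cong P _ _ eq-unbind)
    where
      eq-unbind : ∀ z → FV z P → unbind σ y z ≡ unbind σ' y z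
      eq-unbind z z∈P with z ≟ y
      ... | yes _   = refl
      ... | no z≢y  = eq z (inp-P z≢y z∈P)
  substP-cong (out c u P)   σ σ' eq =
    cong₂ (out c) (substT-cong σ σ' u (λ z z∈u → eq z (out-u z∈u)))
                  (substP-cong P σ σ' (λ z z∈P → eq z (out-P z∈P)))

  substP-id : ∀ P σ → (∀ z → σ z ≡ at (vr z)) → substP σ P ≡ P
  substP-id nil           σ eq = refl
  substP-id (ite u v P Q) σ eq =
    cong₂ (λ (u' , v') (P' , Q') → ite u' v' P' Q')
      (cong₂ _,_ (substT-id σ u (λ z _ → eq z)) (substT-id σ v (λ z _ → eq z)))
      (cong₂ _,_ (substP-id P σ eq) (substP-id Q σ eq))
  substP-id (inp c y P)   σ eq = cong (inp c y) (substP-id P _ eq-unbind)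
    where
      eq-unbind : ∀ z → unbind σ y z ≡ at (vr z)
      eq-unbind z with z ≟ y
      ... | yes refl = refl
      ... | no _     = eq z
  substP-id (out c u P)   σ eq = cong₂ (out c) (substT-id σ u (λ z _ → eq z)) (substP-id P σ eq)

  substP-closed : ∀ P σ → Closed P → substP σ P ≡ P
  substP-closed P σ closed =
    trans (substP-cong P σ (λ z → at (vr z)) (λ z z∈P → ⊥-elim (closed z z∈P)))
          (substP-id P _ (λ _ → refl))

  -- Occ counts binders too, so τ cannot capture a variable bound in P.
  CaptureFree : Subst → Proc → Set
  CaptureFree τ P = ∀ b → Occ b P → ∀ z → b ∈V τ z → z ≡ b

  substP-∘ : ∀ P σ τ ρ → (∀ z → substT σ (τ z) ≡ ρ z) → CaptureFree τ P →
             substP σ (substP τ P) ≡ substP ρ P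
  substP-∘ nil           σ τ ρ eq free = refl
  substP-∘ (ite u v P Q) σ τ ρ eq free =
    cong₂ (λ (u' , v') (P' , Q') → ite u' v' P' Q')
      (cong₂ _,_ (substT-∘ σ τ ρ u eq) (substT-∘ σ τ ρ v eq))
      (cong₂ _,_ (substP-∘ P σ τ ρ eq (λ b o → free b (ite-P o)))
                 (substP-∘ Q σ τ ρ eq (λ b o → free b (ite-Q o))))
  substP-∘ (out c u P)   σ τ ρ eq free =
    cong₂ (out c) (substT-∘ σ τ ρ u eq) (substP-∘ P σ τ ρ eq (λ b o → free b (out-P o)))
  substP-∘ (inp c y P)   σ τ ρ eq free = cong (inp c y) (substP-∘ P _ _ _ eq-unbind free-unbind)
    where
      eq-unbind : ∀ z → substT (unbind σ y) (unbind τ y z) ≡ unbind ρ y z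
      eq-unbind z with z ≟ y
      ... | yes refl = unbind-≡ σ z
      ... | no z≢y   = trans (substT-cong (unbind σ y) σ (τ z) σ-agrees) (eq z)
        where
          σ-agrees : ∀ a → a ∈V τ z → unbind σ y a ≡ σ a
          σ-agrees a a∈τz with a ≟ y
          ... | yes refl = ⊥-elim (z≢y (free a inp-b z a∈τz))
          ... | no _     = refl
      free-unbind : CaptureFree (unbind τ y) P
      free-unbind b o z b∈τz with z ≟ y
      ... | yes refl = sym (∈V-var⁻ b∈τz)
      ... | no _     = free b (inp-P o) z b∈τz

  -- Both sides equal P under the ground substitution z ↦ λ({y ↦ x} z).
  substP-fresh-input : (lam : Subst) → (∀ z → Ground (lam z)) → ∀ y x Q → ¬ Occ x Q →
    substP lam (substP (single y (at (vr x))) Q) ≡ substP (single y (lam x)) (substP (unbind lam y) Q)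
  substP-fresh-input lam ground y x Q x∉Q =
    trans (substP-∘ Q lam _ ρ (λ _ → refl) single-capture-free)
          (sym (substP-∘ Q _ _ ρ instantiate-unbind unbind-capture-free))
    where
      ρ : Subst
      ρ z = substT lam (single y (at (vr x)) z)

      single-capture-free : CaptureFree (single y (at (vr x))) Q
      single-capture-free b b∈Q z b∈τz with ≡-or-≢ z y
      ... | inj₁ refl = ⊥-elim (x∉Q (subst (λ a → Occ a Q)
                                       (∈V-var⁻ (subst (b ∈V_) (single-≡ z (at (vr x))) b∈τz)) b∈Q))
      ... | inj₂ z≢y  = sym (∈V-var⁻ (subst (b ∈V_) (single-≢ y (at (vr x)) z z≢y) b∈τz))

      unbind-capture-free : CaptureFree (unbind lam y) Q
      unbind-capture-free b _ z b∈τz with ≡-or-≢ z y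
      ... | inj₁ refl = sym (∈V-var⁻ (subst (b ∈V_) (unbind-≡ lam z) b∈τz))
      ... | inj₂ z≢y  = ⊥-elim (ground z b (subst (b ∈V_) (unbind-≢ lam y z z≢y) b∈τz))

      instantiate-unbind : ∀ z → substT (single y (lam x)) (unbind lam y z) ≡ ρ z
      instantiate-unbind z with ≡-or-≢ z y
      ... | inj₁ refl rewrite unbind-≡ lam z | single-≡ z (lam x) | single-≡ z (at (vr x)) = refl
      ... | inj₂ z≢y  rewrite unbind-≢ lam y z z≢y | single-≢ y (at (vr x)) z z≢y =
        substT-ground _ (lam z) (ground z)

  map-substP-closed : ∀ σ Ps → All Closed Ps → map (substP σ) Ps ≡ Ps
  map-substP-closed σ []       []                 = refl
  map-substP-closed σ (P ∷ Ps) (closed ∷ closeds) =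
    cong₂ _∷_ (substP-closed P σ closed) (map-substP-closed σ Ps closeds)

  dom-substF : ∀ σ Φ → dom (substF σ Φ) ≡ dom Φ
  dom-substF σ []      = refl
  dom-substF σ (p ∷ Φ) = cong (proj₁ p ∷_) (dom-substF σ Φ)

  substF-ground : ∀ σ Φ → ValidFrame Φ → substF σ Φ ≡ Φ
  substF-ground σ []            []             = refl
  substF-ground σ ((w , t) ∷ Φ) (valid ∷ valids) =
    cong₂ _∷_ (cong (w ,_) (substT-ground σ t (proj₁ valid))) (substF-ground σ Φ valids)

  look-++ : ∀ Φ Ψ w → w ∈ dom Φ → look (Φ ++ Ψ) w ≡ look Φ w
  look-++ []             Ψ w ()
  look-++ ((w' , t) ∷ Φ) Ψ w w∈Φ with w ≟ w'
  ... | yes _ = refl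
  ... | no w≢w' with w∈Φ
  ...   | here w≡w'  = ⊥-elim (w≢w' w≡w')
  ...   | there w∈Φ' = look-++ Φ Ψ w w∈Φ'

  ·-≼ : ∀ {Φ Φ'} M → Φ ≼ Φ' → RecipeOver (dom Φ) M → M · Φ' ≡ M · Φ
  ·-≼ {Φ} M (Ψ , refl) over = bind-cong _ _ M (λ w w∈M → look-++ Φ Ψ w (over w w∈M))

module Monotonicity (Sg : Signature) (Th : Theory Sg) where
  open Model Sg Th

  SStep-extends : ∀ {ctx ℓ Q Φ S tr R Φ' S'} →
                  SStep ctx ℓ Q Φ S tr R Φ' S' → Φ ≼ Φ' × S ≼ S'
  SStep-extends (s-in _ _ _ run)      = map₂′ ∷ʳ-≼ (SStep-extends run)
  SStep-extends (s-out _ _ run)       = map₁ ∷ʳ-≼ (SStep-extends run)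
  SStep-extends (s-then run)          = map₂′ ∷ʳ-≼ (SStep-extends run)
  SStep-extends (s-else run)          = map₂′ ∷ʳ-≼ (SStep-extends run)
  SStep-extends (s-nil-o {Φ} {S})     = ≼-refl Φ , ≼-refl S
  SStep-extends (s-inp-o {Φ = Φ} {S}) = ≼-refl Φ , ≼-refl S
  SStep-extends (s-bad-o {Φ = Φ} {S}) = ≼-refl Φ , ≼-∷ʳ S _
  SStep-extends (s-nil-i {Φ} {S})     = ≼-refl Φ , ≼-refl S
  SStep-extends (s-bad-i {Φ = Φ} {S}) = ≼-refl Φ , ≼-∷ʳ S _

  SSimple-extends : ∀ {Ps Φ S tr Ps' Φ' S'} →
                    SSimple Ps Φ S tr Ps' Φ' S' → Φ ≼ Φ' × S ≼ S'
  SSimple-extends (done {Φ = Φ} {S}) = ≼-refl Φ , ≼-refl S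
  SSimple-extends (keep step run)    = zip′ ≼-trans ≼-trans (SStep-extends step) (SSimple-extends run)
  SSimple-extends (kill step run)    = zip′ ≼-trans ≼-trans (SStep-extends step) (SSimple-extends run)

module Soundness (Sg : Signature) (Th : Theory Sg)
                 {Φf : Model.Frame Sg Th} {Sf : List (Model.Constr Sg Th)}
                 {θ : ℕ → Terms.Recipe Sg} {lam : Terms.Subst Sg}
                 (sol : Model.IsSolWith Sg Th Φf Sf θ lam) where
  open Model Sg Th
  open Substitution Sg Th
  open Monotonicity Sg Th
  open IsSolWith sol

  sat-added : ∀ {S S'} c → (S ∷ʳ c) ≼ S' → S' ≼ Sf → SatC Φf θ lam c
  sat-added c S∷ʳc≼S' S'≼Sf = All-last c sat (≼-trans S∷ʳc≼S' S'≼Sf)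

  neqc-refutes : ∀ u v → SatC Φf θ lam (neqc u v) →
    ¬ (substT lam u ≈E substT lam v × Valid (substT lam u) × Valid (substT lam v))
  neqc-refutes u v (inj₁ u≉v)        (u≈v , _ , _)   = u≉v u≈v
  neqc-refutes u v (inj₂ (inj₁ ¬vu)) (_ , vu , _)    = ¬vu vu
  neqc-refutes u v (inj₂ (inj₂ ¬vv)) (_ , _ , vv)    = ¬vv vv

  neqc-self-invalid : ∀ u → SatC Φf θ lam (neqc u u) → ¬ Valid (substT lam u)
  neqc-self-invalid u sat-u≠u vu = neqc-refutes u u sat-u≠u (E-refl , vu , vu)

  mapR : Maybe Proc → Maybe Proc
  mapR = Maybe.map (substP lam)

  SStep⇒CStep : ∀ {ctx ℓ Q Φ S tr R Φ' S'} → SStep ctx ℓ Q Φ S tr R Φ' S' →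
    Φ' ≼ Φf → S' ≼ Sf →
    CStep ℓ (substP lam Q) (substF lam Φ) (map (mapAct θ) tr) (mapR R) (substF lam Φ')
  SStep⇒CStep (s-in {y = y} {Q} {Φ} {X = X} {x} l _ (_ , x∉inp , _) run) Φ'≼ S'≼
    with sat-added (ded (dom Φ) X x) (proj₂ (SStep-extends run)) S'≼
  ... | over , valid-Xθ , valid-x , Xθ≈x =
    c-in l over' (subst (_≈E lam x) eval-≡ Xθ≈x) (subst Valid eval-≡ valid-Xθ) valid-x
      (subst (λ P → CStep iS P _ _ _ _)
        (substP-fresh-input lam lam-ground y x Q (λ x∈Q → x∉inp (inp-P x∈Q)))
        (SStep⇒CStep run Φ'≼ S'≼))
    where
      over' : RecipeOver (dom (substF lam Φ)) (θ X)
      over' = subst (λ D → RecipeOver D (θ X)) (sym (dom-substF lam Φ)) over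
      eval-≡ : θ X · substF lam Φf ≡ θ X · substF lam Φ
      eval-≡ = ·-≼ (θ X) (≼-map _ (≼-trans (proj₁ (SStep-extends run)) Φ'≼)) over'
  SStep⇒CStep (s-out {u = u} {Φ = Φ} {w = w} l w∉Φ run) Φ'≼ S'≼ =
    c-out l (subst (w ∉_) (sym (dom-substF lam Φ)) w∉Φ) valid-u
      (subst (λ Ψ → CStep oS _ Ψ _ _ _) (map-++ _ Φ ((w , u) ∷ [])) (SStep⇒CStep run Φ'≼ S'≼))
    where
      Φ∷ʳwu≼ : substF lam (Φ ∷ʳ (w , u)) ≼ substF lam Φf
      Φ∷ʳwu≼ = ≼-map _ (≼-trans (proj₁ (SStep-extends run)) Φ'≼)
      valid-u : Valid (substT lam u)
      valid-u = All-last (w , substT lam u) frame-valid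
                  (subst (_≼ substF lam Φf) (map-++ _ Φ ((w , u) ∷ [])) Φ∷ʳwu≼)
  SStep⇒CStep (s-then {u = u} {v} run) Φ'≼ S'≼ =
    let u≈v , vu , vv = sat-added (eqc u v) (proj₂ (SStep-extends run)) S'≼
    in c-then u≈v vu vv (SStep⇒CStep run Φ'≼ S'≼)
  SStep⇒CStep (s-else {u = u} {v} run) Φ'≼ S'≼ =
    c-else (neqc-refutes u v (sat-added (neqc u v) (proj₂ (SStep-extends run)) S'≼))
           (SStep⇒CStep run Φ'≼ S'≼)
  SStep⇒CStep s-nil-o _ _ = c-nil-o
  SStep⇒CStep s-inp-o _ _ = c-inp-o
  SStep⇒CStep s-nil-i _ _ = c-nil-i
  SStep⇒CStep (s-bad-o {u = u}) _ S'≼ =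
    c-bad-o (neqc-self-invalid u (sat-added (neqc u u) (≼-refl _) S'≼))
  SStep⇒CStep (s-bad-i {u = u}) _ S'≼ =
    c-bad-i (neqc-self-invalid u (sat-added (neqc u u) (≼-refl _) S'≼))

  SSimple⇒CSimple : ∀ {Ps Φ S tr Ps' Φ' S'} → SSimple Ps Φ S tr Ps' Φ' S' →
    Φ' ≼ Φf → S' ≼ Sf →
    CSimple (map (substP lam) Ps) (substF lam Φ) (map (mapAct θ) tr)
            (map (substP lam) Ps') (substF lam Φ')
  SSimple⇒CSimple done _ _ = done
  SSimple⇒CSimple (keep {Ps₁} {Ps₂} {Q} {Q'} {tr = tr} {tr'} step run) Φ'≼ S'≼ =
    let Φ≼ , S≼ = SSimple-extends run in
    subst₂ (λ Ps T → CSimple Ps _ T _ _)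
      (sym (map-++ _ Ps₁ (Q ∷ Ps₂))) (sym (map-++ _ tr tr'))
      (keep (SStep⇒CStep step (≼-trans Φ≼ Φ'≼) (≼-trans S≼ S'≼))
            (subst (λ Ps → CSimple Ps _ _ _ _) (map-++ _ Ps₁ (Q' ∷ Ps₂))
                   (SSimple⇒CSimple run Φ'≼ S'≼)))
  SSimple⇒CSimple (kill {Ps₁} {Ps₂} {Q} {tr = tr} {tr'} step run) Φ'≼ S'≼ =
    let Φ≼ , S≼ = SSimple-extends run in
    subst₂ (λ Ps T → CSimple Ps _ T _ _)
      (sym (map-++ _ Ps₁ (Q ∷ Ps₂))) (sym (map-++ _ tr tr'))
      (kill (SStep⇒CStep step (≼-trans Φ≼ Φ'≼) (≼-trans S≼ S'≼))
            (SSimple⇒CSimple run Φ'≼ S'≼))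

proposition3 : (Sg : Signature) (Th : Theory Sg) →
    let open Model Sg Th in
    (Ps : List Proc) (Φ : Frame) → ExtSimple Ps Φ →
    (tr : STrace) (Ps' : List Proc) (Φ' : Frame) (S' : List Constr) →
    SSimple Ps Φ [] tr Ps' Φ' S' →
    (θ : ℕ → Recipe) (lam : Subst) → IsSolWith Φ' S' θ lam →
    CSimple Ps Φ (map (mapAct θ) tr) (map (substP lam) Ps') (substF lam Φ')
proposition3 Sg Th Ps Φ (_ , closed , valid , _) tr Ps' Φ' S' run θ lam sol =
  subst₂ (λ Ps₀ Φ₀ → CSimple Ps₀ Φ₀ _ _ _)
    (map-substP-closed lam Ps closed) (substF-ground lam Φ valid)
    (SSimple⇒CSimple run (≼-refl Φ') (≼-refl S'))
  where
    open Model Sg Th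
    open Substitution Sg Th
    open Soundness Sg Th sol
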